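{- Let $m\in S(4,7)$ and $n\in S(3,7)$, with $m,n\ge 3$, and let $T_{m,n}=C_m\Box C_n$. Then $\chi(T_{m,n}^2)\le 7$.
   Context: For integers $r,s$, $S(r,s)=\{\alpha r+\beta s:\alpha,\beta \text{ nonnegative integers}\}$. $C_k$ denotes the cycle on $k$ vertices; $\Box$ is the Cartesian product of graphs ($(u_1,v_1)\sim(u_2,v_2)$ iff $u_1=u_2$ and $v_1v_2$ is an edge, or $v_1=v_2$ and $u_1u_2$ is an edge). The square $G^2$ of a graph $G$ has vertex set $V(G)$, two distinct vertices being adjacent iff their distance in $G$ is at most 2. $\chi$ is the chromatic number. -}

module Defs where

open import Data.Nat using (ℕ; suc; _+_; _*_; NonZero)
open import Data.Nat.DivMod using (_%_)
open import Data.Fin using (Fin; toℕ)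
open import Data.Product using (Σ; ∃; _×_; _,_)
open import Data.Sum using (_⊎_)
open import Relation.Binary.PropositionalEquality using (_≡_; _≢_)
open import Level using (0ℓ)

-- A graph: vertex type with an adjacency relation (symmetric, irreflexive
-- for all graphs built below).
record Graph : Set₁ where
  field
    V   : Set
    Adj : V → V → Set
open Graph public

S : ℕ → ℕ → ℕ → Set
S r s x = Σ ℕ λ α → Σ ℕ λ β → x ≡ α * r + β * s

-- The cycle C_k on vertices Fin k (i ~ j iff j ≡ i+1 or i ≡ j+1 mod k);
-- a genuine cycle when k ≥ 3.
Cycle : (k : ℕ) → .{{NonZero k}} → Graph
Cycle k = record
  { V = Fin k
  ; Adj = λ i j → (toℕ j ≡ suc (toℕ i) % k) ⊎ (toℕ i ≡ suc (toℕ j) % k)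
  }

_□_ : Graph → Graph → Graph
G □ H = record
  { V = V G × V H
  ; Adj = λ { (u₁ , v₁) (u₂ , v₂) →
        (u₁ ≡ u₂ × Adj H v₁ v₂) ⊎ (v₁ ≡ v₂ × Adj G u₁ u₂) }
  }

square : Graph → Graph
square G = record
  { V = V G
  ; Adj = λ u v → u ≢ v × (Adj G u v ⊎ Σ (V G) λ w → Adj G u w × Adj G w v)
  }

ProperColouring : (G : Graph) → (k : ℕ) → (V G → Fin k) → Set
ProperColouring G k c = ∀ u v → Adj G u v → c u ≢ c v

χ≤ : Graph → ℕ → Set
χ≤ G k = Σ (V G → Fin k) λ c → ProperColouring G k c

T : (m n : ℕ) → .{{NonZero m}} → .{{NonZero n}} → Graph
T m n = Cycle m □ Cycle n

module Submission where

-- The colouring factors through a finite "pattern torus".  Orient C_m by its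
-- successor relation i ↦ i+1 (mod m).  Two distinct vertices of the square
-- of C_m □ C_n are then related by one of six directed configurations
-- (one or two steps along a coordinate, or one step along each), see Near₂.
-- Any labelling ℓ of C_m by a closed walk in a digraph R maps these
-- configurations to the same configurations in R, so a colouring of the
-- pattern graph of (R , Q) pulls back to a proper colouring of T²_{m,n}.
--
-- The pattern for C_m has two blocks 0→1→2→3 and 4→…→10, where the end of
-- each block may step to the start of either block; concatenating a copies
-- of the first block and b copies of the second closes up to a walk of
-- length 4a + 7b, i.e. of every length in S(4,7).  Likewise blocks of
-- lengths 3 and 7 on Fin 10 cover S(3,7).  Finally an explicit 11 × 10
-- table of 7 colours separates all six configurations, which is checked by
-- evaluation.

open import Defs
open import Data.Nat using (ℕ; zero; suc; _+_; _*_; _≥_; NonZero; _<?_)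
open import Data.Nat.DivMod using (_%_; m<n⇒m%n≡m; n%n≡0)
open import Data.Nat.Properties using (suc-injective; ≤-antisym; ≮⇒≥; 1+n≢0)
open import Data.Fin using (Fin; toℕ; zero; suc; #_)
open import Data.Fin.Properties using (toℕ-injective; toℕ<n; _≟_)
  renaming (all? to all-fin?)
open import Data.List using (List; []; _∷_; _++_; length; lookup; concat; replicate; head)
open import Data.List.Properties using (length-++; ++-assoc)
open import Data.List.Relation.Unary.Linked using (Linked; []; [-]; _∷_)
open import Data.List.Relation.Unary.All using (All)
import Data.List.Relation.Unary.All as All
open import Data.List.Relation.Unary.Any using (here; there)
open import Data.List.Membership.Propositional using (_∈_)
open import Data.Maybe.Relation.Unary.All using (just; nothing)
  renaming (All to MaybeAll)
import Data.Vec as Vec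
open import Data.Vec using (Vec; []; _∷_)
open import Data.Product using (Σ; _×_; _,_; uncurry)
import Data.Product as Product
open import Data.Sum using (_⊎_; inj₁; inj₂)
import Data.Sum as Sum
open import Data.Empty using (⊥-elim)
open import Function using (_∘_)
open import Relation.Nullary using (Dec; yes; no; ¬?; _×-dec_)
open import Relation.Nullary.Decidable using (toWitness)
open import Relation.Binary.PropositionalEquality
  using (_≡_; _≢_; refl; sym; trans; cong; cong₂; subst; ≢-sym; module ≡-Reasoning)

Homomorphism : (G H : Graph) → (V G → V H) → Set
Homomorphism G H f = ∀ u v → Adj G u v → Adj H (f u) (f v)

colouring-pullback : ∀ {G H k f c} → Homomorphism G H f →
  ProperColouring H k c → ProperColouring G k (c ∘ f)
colouring-pullback hom proper u v uv = proper _ _ (hom u v uv)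

Succ : (m : ℕ) → .{{NonZero m}} → Fin m → Fin m → Set
Succ m i j = toℕ j ≡ suc (toℕ i) % m

successor-cases : ∀ m .{{_ : NonZero m}} (i : Fin m) →
  (suc (toℕ i) % m ≡ suc (toℕ i)) ⊎ (suc (toℕ i) % m ≡ 0 × suc (toℕ i) ≡ m)
successor-cases m i with suc (toℕ i) <? m
... | yes lt = inj₁ (m<n⇒m%n≡m lt)
... | no ¬lt = inj₂ (trans (cong (_% m) last) (n%n≡0 m) , last)
  where
  last : suc (toℕ i) ≡ m
  last = ≤-antisym (toℕ<n i) (≮⇒≥ ¬lt)

succ-functional : ∀ {m} .{{_ : NonZero m}} {i j j' : Fin m} →
  Succ m i j → Succ m i j' → j ≡ j'
succ-functional i↦j i↦j' = toℕ-injective (trans i↦j (sym i↦j'))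

succ-injective : ∀ {m} .{{_ : NonZero m}} {i i' j : Fin m} →
  Succ m i j → Succ m i' j → i ≡ i'
succ-injective {m} {i} {i'} i↦j i'↦j = same-residue (trans (sym i↦j) i'↦j)
  where
  same-residue : suc (toℕ i) % m ≡ suc (toℕ i') % m → i ≡ i'
  same-residue eq with successor-cases m i | successor-cases m i'
  ... | inj₁ no-wrap      | inj₁ no-wrap'      =
    toℕ-injective (suc-injective (trans (sym no-wrap) (trans eq no-wrap')))
  ... | inj₂ (_ , last)   | inj₂ (_ , last')   =
    toℕ-injective (suc-injective (trans last (sym last')))
  ... | inj₁ no-wrap      | inj₂ (wrap' , _)   =
    ⊥-elim (1+n≢0 (trans (sym no-wrap) (trans eq wrap')))
  ... | inj₂ (wrap , _)   | inj₁ no-wrap'      =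
    ⊥-elim (1+n≢0 (trans (sym no-wrap') (trans (sym eq) wrap)))

cycle-path₂ : ∀ {m} .{{_ : NonZero m}} {u w v : Fin m} → u ≢ v →
  Adj (Cycle m) u w → Adj (Cycle m) w v →
  (Succ m u w × Succ m w v) ⊎ (Succ m v w × Succ m w u)
cycle-path₂ u≢v (inj₁ u↦w) (inj₁ w↦v) = inj₁ (u↦w , w↦v)
cycle-path₂ u≢v (inj₂ w↦u) (inj₂ v↦w) = inj₂ (v↦w , w↦u)
cycle-path₂ u≢v (inj₁ u↦w) (inj₂ v↦w) = ⊥-elim (u≢v (succ-injective u↦w v↦w))
cycle-path₂ u≢v (inj₂ w↦u) (inj₁ w↦v) = ⊥-elim (u≢v (succ-functional w↦u w↦v))

data Near₂ {A B : Set} (R : A → A → Set) (Q : B → B → Set) :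
     A × B → A × B → Set where
  vertical     : ∀ {x y y'} → Q y y' → Near₂ R Q (x , y) (x , y')
  horizontal   : ∀ {x x' y} → R x x' → Near₂ R Q (x , y) (x' , y)
  vertical²    : ∀ {x y y' y''} → Q y y' → Q y' y'' → Near₂ R Q (x , y) (x , y'')
  horizontal²  : ∀ {x x' x'' y} → R x x' → R x' x'' → Near₂ R Q (x , y) (x'' , y)
  diagonal     : ∀ {x x' y y'} → R x x' → Q y y' → Near₂ R Q (x , y) (x' , y')
  antidiagonal : ∀ {x x' y y'} → R x x' → Q y' y → Near₂ R Q (x , y) (x' , y')

nearGraph : {A B : Set} → (A → A → Set) → (B → B → Set) → Graph
nearGraph {A} {B} R Q = record
  { V = A × B ; Adj = λ p q → Near₂ R Q p q ⊎ Near₂ R Q q p }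

steps-near : ∀ {A B} {R : A → A → Set} {Q : B → B → Set} {x x' y y'} →
  R x x' ⊎ R x' x → Q y y' ⊎ Q y' y → Adj (nearGraph R Q) (x , y) (x' , y')
steps-near (inj₁ r) (inj₁ q) = inj₁ (diagonal r q)
steps-near (inj₁ r) (inj₂ q) = inj₁ (antidiagonal r q)
steps-near (inj₂ r) (inj₁ q) = inj₂ (antidiagonal r q)
steps-near (inj₂ r) (inj₂ q) = inj₂ (diagonal r q)

torus-square-near : ∀ {m n} .{{_ : NonZero m}} .{{_ : NonZero n}} →
  Homomorphism (square (T m n)) (nearGraph (Succ m) (Succ n)) (λ u → u)
torus-square-near _ _ (_ , inj₁ (inj₁ (refl , q))) = Sum.map vertical vertical q
torus-square-near _ _ (_ , inj₁ (inj₂ (refl , r))) = Sum.map horizontal horizontal r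
torus-square-near (x , _) _ (u≢v , inj₂ (_ , inj₁ (refl , q) , inj₁ (refl , q'))) =
  Sum.map (uncurry vertical²) (uncurry vertical²)
    (cycle-path₂ (u≢v ∘ cong (x ,_)) q q')
torus-square-near (_ , y) _ (u≢v , inj₂ (_ , inj₂ (refl , r) , inj₂ (refl , r'))) =
  Sum.map (uncurry horizontal²) (uncurry horizontal²)
    (cycle-path₂ (u≢v ∘ cong (_, y)) r r')
torus-square-near _ _ (_ , inj₂ (_ , inj₁ (refl , q) , inj₂ (refl , r))) = steps-near r q
torus-square-near _ _ (_ , inj₂ (_ , inj₂ (refl , r) , inj₁ (refl , q))) = steps-near r q

near₂-map : ∀ {A A' B B'} {R : A → A → Set} {R' : A' → A' → Set}
  {Q : B → B → Set} {Q' : B' → B' → Set} {f : A → A'} {g : B → B'} →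
  (∀ {x x'} → R x x' → R' (f x) (f x')) → (∀ {y y'} → Q y y' → Q' (g y) (g y')) →
  ∀ {p q} → Near₂ R Q p q → Near₂ R' Q' (Product.map f g p) (Product.map f g q)
near₂-map F G (vertical q)        = vertical (G q)
near₂-map F G (horizontal r)      = horizontal (F r)
near₂-map F G (vertical² q q')    = vertical² (G q) (G q')
near₂-map F G (horizontal² r r')  = horizontal² (F r) (F r')
near₂-map F G (diagonal r q)      = diagonal (F r) (G q)
near₂-map F G (antidiagonal r q)  = antidiagonal (F r) (G q)

ClosedWalk : {L : Set} → (L → L → Set) → (m : ℕ) → .{{NonZero m}} → (Fin m → L) → Set
ClosedWalk R m ℓ = ∀ {i j} → Succ m i j → R (ℓ i) (ℓ j)

walks-near : ∀ {m n} .{{_ : NonZero m}} .{{_ : NonZero n}} {A B}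
  {R : A → A → Set} {Q : B → B → Set} {ℓ₁ : Fin m → A} {ℓ₂ : Fin n → B} →
  ClosedWalk R m ℓ₁ → ClosedWalk Q n ℓ₂ →
  Homomorphism (nearGraph (Succ m) (Succ n)) (nearGraph R Q) (Product.map ℓ₁ ℓ₂)
walks-near walk₁ walk₂ _ _ =
  Sum.map (near₂-map walk₁ walk₂) (near₂-map walk₁ walk₂)

module _ {L : Set} {R : L → L → Set} where

  walk-step : ∀ {w y} → Linked R (w ++ y ∷ []) → (i j : Fin (length w)) →
    toℕ j ≡ suc (toℕ i) → R (lookup w i) (lookup w j)
  walk-step {x ∷ x' ∷ w} (r ∷ _)  zero    (suc zero)    _  = r
  walk-step {x ∷ x' ∷ w} (_ ∷ rs) (suc i) (suc j)       eq =
    walk-step {x' ∷ w} rs i j (suc-injective eq)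
  walk-step {x ∷ x' ∷ w} _        zero    zero          ()
  walk-step {x ∷ x' ∷ w} _        zero    (suc (suc _)) ()
  walk-step {x ∷ x' ∷ w} _        (suc _) zero          ()
  walk-step {x ∷ []}     _        zero    zero          ()

  walk-exit : ∀ {w y} → Linked R (w ++ y ∷ []) → (i : Fin (length w)) →
    suc (toℕ i) ≡ length w → R (lookup w i) y
  walk-exit {x ∷ []}     (r ∷ _)  zero    _  = r
  walk-exit {x ∷ x' ∷ w} (_ ∷ rs) (suc i) eq = walk-exit {x' ∷ w} rs i (suc-injective eq)
  walk-exit {x ∷ x' ∷ w} _        zero    ()

  linked-join : ∀ {u s r} → Linked R (u ++ s ∷ []) → Linked R (s ∷ r) → Linked R (u ++ s ∷ r)
  linked-join {[]}         _        rs = rs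
  linked-join {x ∷ []}     (r ∷ _)  rs = r ∷ rs
  linked-join {x ∷ x' ∷ u} (r ∷ us) rs = r ∷ linked-join {x' ∷ u} us rs

copies : {L : Set} → ℕ → List L → List L
copies k u = concat (replicate k u)

length-copies : {L : Set} (k : ℕ) (u : List L) → length (copies k u) ≡ k * length u
length-copies zero    u = refl
length-copies (suc k) u = trans (length-++ u) (cong (length u +_) (length-copies k u))

-- Start marks the letters a block may begin with;
-- a block is a walk that may be continued by any start.  Any concatenation of
-- blocks is again a block, and a block that begins with a start closes up
-- into a closed walk on the cycle of its length.
module BlockWalks {L : Set} (R : L → L → Set) (Start : L → Set) where

  Block : List L → Set
  Block w = ∀ {t} → Start t → Linked R (w ++ t ∷ [])

  StartsWell : List L → Set
  StartsWell w = MaybeAll Start (head w)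

  startsWell-++ : ∀ {u v} → StartsWell u → StartsWell v → StartsWell (u ++ v)
  startsWell-++ {[]}    _  sv = sv
  startsWell-++ {_ ∷ _} su _  = su

  block-++ : ∀ {u v} → Block u → StartsWell v → Block v → Block (u ++ v)
  block-++ {u} {v} bu sv bv {t} st =
    subst (Linked R) (sym (++-assoc u v (t ∷ []))) (glue v sv bv)
    where
    glue : ∀ v → StartsWell v → Block v → Linked R (u ++ v ++ t ∷ [])
    glue []      _         _  = bu st
    glue (_ ∷ _) (just ss) bv = linked-join (bu ss) (bv st)

  copies-startsWell : ∀ {u} → StartsWell u → ∀ k → StartsWell (copies k u)
  copies-startsWell su zero    = nothing
  copies-startsWell su (suc k) = startsWell-++ su (copies-startsWell su k)

  copies-block : ∀ {u} → Block u → StartsWell u → ∀ k → Block (copies k u)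
  copies-block bu su zero    _ = [-]
  copies-block bu su (suc k)   =
    block-++ bu (copies-startsWell su k) (copies-block bu su k)

  -- A block starting with a start closes up: its last letter steps back to
  -- its first, so reading it cyclically labels C_m, m = length w, by a
  -- closed walk.  (The empty word labels the empty vertex set.)
  closed-walk-of-word : ∀ m .{{_ : NonZero m}} (w : List L) → m ≡ length w →
    StartsWell w → Block w → Σ (Fin m → L) (ClosedWalk R m)
  closed-walk-of-word _ [] refl _ _ = (λ ()) , λ { {()} }
  closed-walk-of-word m (s ∷ w) refl (just start) block = lookup (s ∷ w) , step
    where
    step : ClosedWalk R m (lookup (s ∷ w))
    step {i} {j} i↦j with successor-cases m i
    ... | inj₁ no-wrap = walk-step (block start) i j (trans i↦j no-wrap)
    ... | inj₂ (wrap , last) rewrite toℕ-injective {i = j} {j = zero} (trans i↦j wrap) =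
      walk-exit (block start) i last

  walk-of-blocks : ∀ {u v} → Block u → StartsWell u → Block v → StartsWell v →
    ∀ m .{{_ : NonZero m}} → S (length u) (length v) m → Σ (Fin m → L) (ClosedWalk R m)
  walk-of-blocks {u} {v} bu su bv sv m (a , b , m≡) =
    closed-walk-of-word m (copies a u ++ copies b v) length-word
      (startsWell-++ (copies-startsWell su a) (copies-startsWell sv b))
      (block-++ (copies-block bu su a) (copies-startsWell sv b) (copies-block bv sv b))
    where
    open ≡-Reasoning
    length-word : m ≡ length (copies a u ++ copies b v)
    length-word = begin
      m                                           ≡⟨ m≡ ⟩
      a * length u + b * length v                 ≡⟨ sym (cong₂ _+_ (length-copies a u) (length-copies b v)) ⟩
      length (copies a u) + length (copies b v)   ≡⟨ sym (length-++ (copies a u)) ⟩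
      length (copies a u ++ copies b v)           ∎

Successor : {A : Set} → (A → List A) → A → A → Set
Successor next x x' = x' ∈ next x

-- For digraphs given by successor lists, a colouring c of the pattern graph
-- is proper as soon as it separates the six configurations of Near₂ around
-- every base point; this local condition is a finite list of checks.
module Separation {A B : Set} (nextA : A → List A) (nextB : B → List B)
                  {k : ℕ} (c : A × B → Fin k) where

  -- The six conditions at base point (x , y), in the order of the
  -- constructors of Near₂; the antidiagonal one compares (x , y') with (x' , y).
  LocallySeparated : A → B → Set
  LocallySeparated x y =
      All (λ y' → c (x , y) ≢ c (x , y')) (nextB y)
    × All (λ x' → c (x , y) ≢ c (x' , y)) (nextA x)
    × All (λ y' → All (λ y'' → c (x , y) ≢ c (x , y'')) (nextB y')) (nextB y)
    × All (λ x' → All (λ x'' → c (x , y) ≢ c (x'' , y)) (nextA x')) (nextA x)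
    × All (λ x' → All (λ y' → c (x , y) ≢ c (x' , y')) (nextB y)) (nextA x)
    × All (λ x' → All (λ y' → c (x , y') ≢ c (x' , y)) (nextB y)) (nextA x)

  locally-separated? : ∀ x y → Dec (LocallySeparated x y)
  locally-separated? x y =
        All.all? (λ y' → ¬? (c (x , y) ≟ c (x , y'))) (nextB y)
    ×-dec All.all? (λ x' → ¬? (c (x , y) ≟ c (x' , y))) (nextA x)
    ×-dec All.all? (λ y' → All.all? (λ y'' → ¬? (c (x , y) ≟ c (x , y''))) (nextB y')) (nextB y)
    ×-dec All.all? (λ x' → All.all? (λ x'' → ¬? (c (x , y) ≟ c (x'' , y))) (nextA x')) (nextA x)
    ×-dec All.all? (λ x' → All.all? (λ y' → ¬? (c (x , y) ≟ c (x' , y'))) (nextB y)) (nextA x)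
    ×-dec All.all? (λ x' → All.all? (λ y' → ¬? (c (x , y') ≟ c (x' , y))) (nextB y)) (nextA x)

  separated : (∀ x y → LocallySeparated x y) →
    ∀ {p q} → Near₂ (Successor nextA) (Successor nextB) p q → c p ≢ c q
  separated local (vertical {x} {y} q) =
    let (sep , _) = local x y in All.lookup sep q
  separated local (horizontal {x} {_} {y} r) =
    let (_ , sep , _) = local x y in All.lookup sep r
  separated local (vertical² {x} {y} q q') =
    let (_ , _ , sep , _) = local x y in All.lookup (All.lookup sep q) q'
  separated local (horizontal² {x} {_} {_} {y} r r') =
    let (_ , _ , _ , sep , _) = local x y in All.lookup (All.lookup sep r) r'
  separated local (diagonal {x} {_} {y} r q) =
    let (_ , _ , _ , _ , sep , _) = local x y in All.lookup (All.lookup sep r) q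
  separated local (antidiagonal {x} {_} {_} {y'} r q) =
    let (_ , _ , _ , _ , _ , sep) = local x y' in All.lookup (All.lookup sep r) q

  proper : (∀ x y → LocallySeparated x y) →
    ProperColouring (nearGraph (Successor nextA) (Successor nextB)) k c
  proper local _ _ (inj₁ near) = separated local near
  proper local _ _ (inj₂ near) = ≢-sym (separated local near)

nextA : Fin 11 → List (Fin 11)
nextA = Vec.lookup
  ( (# 1 ∷ []) ∷ (# 2 ∷ []) ∷ (# 3 ∷ []) ∷ (# 0 ∷ # 4 ∷ [])
  ∷ (# 5 ∷ []) ∷ (# 6 ∷ []) ∷ (# 7 ∷ []) ∷ (# 8 ∷ []) ∷ (# 9 ∷ []) ∷ (# 10 ∷ [])
  ∷ (# 0 ∷ # 4 ∷ []) ∷ [])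

wordA₁ : List (Fin 11)
wordA₁ = # 0 ∷ # 1 ∷ # 2 ∷ # 3 ∷ []

wordA₂ : List (Fin 11)
wordA₂ = # 4 ∷ # 5 ∷ # 6 ∷ # 7 ∷ # 8 ∷ # 9 ∷ # 10 ∷ []

module PatternA = BlockWalks (Successor nextA) (λ t → t ≡ # 0 ⊎ t ≡ # 4)

blockA₁ : PatternA.Block wordA₁
blockA₁ (inj₁ refl) = here refl ∷ here refl ∷ here refl ∷ here refl ∷ [-]
blockA₁ (inj₂ refl) = here refl ∷ here refl ∷ here refl ∷ there (here refl) ∷ [-]

blockA₂ : PatternA.Block wordA₂
blockA₂ (inj₁ refl) =
  here refl ∷ here refl ∷ here refl ∷ here refl ∷ here refl ∷ here refl ∷ here refl ∷ [-]
blockA₂ (inj₂ refl) =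
  here refl ∷ here refl ∷ here refl ∷ here refl ∷ here refl ∷ here refl ∷ there (here refl) ∷ [-]

walkA : ∀ m .{{_ : NonZero m}} → S 4 7 m → Σ (Fin m → Fin 11) (ClosedWalk (Successor nextA) m)
walkA = PatternA.walk-of-blocks {wordA₁} {wordA₂}
  blockA₁ (just (inj₁ refl)) blockA₂ (just (inj₂ refl))

nextB : Fin 10 → List (Fin 10)
nextB = Vec.lookup
  ( (# 1 ∷ []) ∷ (# 2 ∷ []) ∷ (# 0 ∷ # 3 ∷ [])
  ∷ (# 4 ∷ []) ∷ (# 5 ∷ []) ∷ (# 6 ∷ []) ∷ (# 7 ∷ []) ∷ (# 8 ∷ []) ∷ (# 9 ∷ [])
  ∷ (# 0 ∷ # 3 ∷ []) ∷ [])

wordB₁ : List (Fin 10)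
wordB₁ = # 0 ∷ # 1 ∷ # 2 ∷ []

wordB₂ : List (Fin 10)
wordB₂ = # 3 ∷ # 4 ∷ # 5 ∷ # 6 ∷ # 7 ∷ # 8 ∷ # 9 ∷ []

module PatternB = BlockWalks (Successor nextB) (λ t → t ≡ # 0 ⊎ t ≡ # 3)

blockB₁ : PatternB.Block wordB₁
blockB₁ (inj₁ refl) = here refl ∷ here refl ∷ here refl ∷ [-]
blockB₁ (inj₂ refl) = here refl ∷ here refl ∷ there (here refl) ∷ [-]

blockB₂ : PatternB.Block wordB₂
blockB₂ (inj₁ refl) =
  here refl ∷ here refl ∷ here refl ∷ here refl ∷ here refl ∷ here refl ∷ here refl ∷ [-]
blockB₂ (inj₂ refl) =
  here refl ∷ here refl ∷ here refl ∷ here refl ∷ here refl ∷ here refl ∷ there (here refl) ∷ [-]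

walkB : ∀ n .{{_ : NonZero n}} → S 3 7 n → Σ (Fin n → Fin 10) (ClosedWalk (Successor nextB) n)
walkB = PatternB.walk-of-blocks {wordB₁} {wordB₂}
  blockB₁ (just (inj₁ refl)) blockB₂ (just (inj₂ refl))

table : Vec (Vec (Fin 7) 10) 11
table =
  (# 6 ∷ # 2 ∷ # 0 ∷ # 6 ∷ # 5 ∷ # 3 ∷ # 0 ∷ # 4 ∷ # 3 ∷ # 0 ∷ []) ∷
  (# 5 ∷ # 4 ∷ # 1 ∷ # 3 ∷ # 4 ∷ # 1 ∷ # 2 ∷ # 6 ∷ # 1 ∷ # 2 ∷ []) ∷
  (# 3 ∷ # 0 ∷ # 6 ∷ # 5 ∷ # 0 ∷ # 6 ∷ # 5 ∷ # 3 ∷ # 0 ∷ # 6 ∷ []) ∷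
  (# 1 ∷ # 5 ∷ # 4 ∷ # 1 ∷ # 2 ∷ # 4 ∷ # 1 ∷ # 2 ∷ # 5 ∷ # 4 ∷ []) ∷
  (# 6 ∷ # 2 ∷ # 0 ∷ # 6 ∷ # 5 ∷ # 0 ∷ # 6 ∷ # 4 ∷ # 3 ∷ # 0 ∷ []) ∷
  (# 4 ∷ # 1 ∷ # 5 ∷ # 3 ∷ # 4 ∷ # 1 ∷ # 3 ∷ # 0 ∷ # 1 ∷ # 5 ∷ []) ∷
  (# 3 ∷ # 6 ∷ # 2 ∷ # 1 ∷ # 0 ∷ # 2 ∷ # 4 ∷ # 5 ∷ # 6 ∷ # 2 ∷ []) ∷
  (# 5 ∷ # 4 ∷ # 0 ∷ # 6 ∷ # 5 ∷ # 3 ∷ # 6 ∷ # 1 ∷ # 3 ∷ # 0 ∷ []) ∷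
  (# 6 ∷ # 3 ∷ # 1 ∷ # 2 ∷ # 4 ∷ # 0 ∷ # 2 ∷ # 4 ∷ # 5 ∷ # 1 ∷ []) ∷
  (# 2 ∷ # 0 ∷ # 4 ∷ # 5 ∷ # 6 ∷ # 1 ∷ # 3 ∷ # 6 ∷ # 0 ∷ # 3 ∷ []) ∷
  (# 1 ∷ # 5 ∷ # 3 ∷ # 1 ∷ # 2 ∷ # 4 ∷ # 5 ∷ # 1 ∷ # 2 ∷ # 4 ∷ []) ∷
  []

colour : Fin 11 × Fin 10 → Fin 7
colour (x , y) = Vec.lookup (Vec.lookup table x) y

module ColourCheck = Separation nextA nextB colour

pattern-colouring :
  ProperColouring (nearGraph (Successor nextA) (Successor nextB)) 7 colour
pattern-colouring = ColourCheck.proper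
  (toWitness {a? = all-fin? λ x → all-fin? λ y → ColourCheck.locally-separated? x y} _)

theorem4 : (m n : ℕ) → S 4 7 m → S 3 7 n → m ≥ 3 → n ≥ 3 →
    .{{_ : NonZero m}} → .{{_ : NonZero n}} →
    χ≤ (square (T m n)) 7
theorem4 m n m∈S n∈S _ _ with walkA m m∈S | walkB n n∈S
... | ℓ₁ , walk₁ | ℓ₂ , walk₂ =
  colour ∘ Product.map ℓ₁ ℓ₂ ,
  colouring-pullback (λ u v uv → walks-near walk₁ walk₂ u v (torus-square-near u v uv))
    pattern-colouring
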